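{- Let $n\ge1$ and let $x=x_1x_2\cdots x_n\in\mathrm{Av}_n(312)$. Then $x$ lies in the image $\mathsf{Pop}_{\mathrm{Av}_n(312)}(\mathrm{Av}_n(312))$ if and only if $x_n=n$ and $x$ has no consecutive double descent, i.e., there is no index $i$ with $x_i>x_{i+1}>x_{i+2}$.
   Context: $S_n$ is ordered by the right weak order: the covering relation is $y\lessdot x$ iff $y$ is obtained from $x=x_1\cdots x_n$ by swapping two adjacent entries $x_i>x_{i+1}$. $\mathrm{Av}_n(312)$ is the set of permutations $x\in S_n$ having no indices $i<j<k$ with $x_j<x_k<x_i$; with the order induced from the right weak order it is a sublattice of $S_n$ (isomorphic to the Tamari lattice). For a finite lattice $M$, $\mathsf{Pop}_M:M\to M$ is defined by $\mathsf{Pop}_M(x)=\bigwedge(\{y\in M: y\lessdot x\}\cup\{x\})$, where covers and meets are taken in $M$; here $M=\mathrm{Av}_n(312)$. -}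

module Defs where

open import Data.Nat using (ℕ; suc)
open import Data.Fin using (Fin; toℕ) renaming (_<_ to _<ᶠ_)
open import Data.Vec using (Vec; []; _∷_; lookup)
open import Data.Product using (Σ; _×_; ∃)
open import Data.Sum using (_⊎_)
open import Relation.Nullary using (¬_)
open import Relation.Binary.PropositionalEquality using (_≡_)
open import Relation.Binary.Construct.Closure.ReflexiveTransitive using (Star)

-- A word of length n with letters in Fin n (values 0..n-1, i.e. shifted by one
-- from the paper's 1..n).  It is a permutation iff it is injective.
Word : ℕ → Set
Word n = Vec (Fin n) n

IsPerm : ∀ {n} → Word n → Set
IsPerm {n} x = ∀ (i j : Fin n) → lookup x i ≡ lookup x j → i ≡ j

Avoids312 : ∀ {n} → Word n → Set
Avoids312 {n} x = ∀ (i j k : Fin n) → i <ᶠ j → j <ᶠ k →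
  ¬ (lookup x j <ᶠ lookup x k × lookup x k <ᶠ lookup x i)

InAv : ∀ {n} → Word n → Set
InAv x = IsPerm x × Avoids312 x

data SwapDesc {A : Set} (_<_ : A → A → Set) : ∀ {m} → Vec A m → Vec A m → Set where
  here  : ∀ {m} {a b : A} {xs : Vec A m} → b < a →
          SwapDesc _<_ (b ∷ a ∷ xs) (a ∷ b ∷ xs)
  there : ∀ {m} {c : A} {ys xs : Vec A m} → SwapDesc _<_ ys xs →
          SwapDesc _<_ (c ∷ ys) (c ∷ xs)

_⋖S_ : ∀ {n} → Word n → Word n → Set
y ⋖S x = SwapDesc _<ᶠ_ y x

_≤W_ : ∀ {n} → Word n → Word n → Set
y ≤W x = Star _⋖S_ y x

_<W_ : ∀ {n} → Word n → Word n → Set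
y <W x = y ≤W x × ¬ (y ≡ x)

_⋖M_ : ∀ {n} → Word n → Word n → Set
_⋖M_ {n} y x = InAv y × InAv x × y <W x ×
  ¬ (Σ (Word n) λ z → InAv z × y <W z × z <W x)

IsMeetInM : ∀ {n} → (Word n → Set) → Word n → Set
IsMeetInM {n} S w = InAv w × (∀ y → S y → w ≤W y) ×
  (∀ v → InAv v → (∀ y → S y → v ≤W y) → v ≤W w)

PopSet : ∀ {n} → Word n → Word n → Set
PopSet x y = InAv y × (y ⋖M x ⊎ y ≡ x)

IsPopOf : ∀ {n} → Word n → Word n → Set
IsPopOf x w = IsMeetInM (PopSet x) w

InPopImage : ∀ {n} → Word n → Set
InPopImage {n} w = Σ (Word n) λ x → InAv x × IsPopOf x w

NoDoubleDescent : ∀ {n} → Word n → Set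
NoDoubleDescent {n} x = ∀ (i j k : Fin n) → toℕ j ≡ suc (toℕ i) → toℕ k ≡ suc (toℕ j) →
  ¬ (lookup x k <ᶠ lookup x j × lookup x j <ᶠ lookup x i)

{-# OPTIONS --safe #-}
-- A permutation x ∈ Av_n(312) is encoded by t = top x, where t b is the largest value a ≥ b
-- occurring before b in x.  Since x avoids 312, for b < a the value a occurs before b exactly
-- when a ≤ t b; the intervals [b, t b] are nested, and every nested family of intervals comes
-- from a unique 312-avoider.  Under this encoding the weak order is the pointwise order, the
-- lower covers of x in Av_n(312) are obtained by lowering t at a single b < t b to
-- prev t b − 1, where prev t b is the least a > b with t b ≤ t a.  Hence Pop(x) is encoded by
-- popTop t, which lowers t at every such b at once.
-- The image of popTop consists of the nested u that map [0, m) into itself and satisfy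
-- u (prev u c) = prev u c whenever c < u c.  The first condition says that the maximum is the
-- last entry; since prev t b is the entry just before b whenever b ends a descent, the second
-- says that there is no double descent.
module Submission where

open import Defs
open import Data.Nat using (ℕ; zero; suc; _+_; pred; _≤_; _<_; z≤n; s≤s; _≤?_; _<?_; _⊔_; >-nonZero)
open import Data.Nat.Properties
open import Data.Fin using (Fin; fromℕ; toℕ; fromℕ<; punchOut) renaming (zero to fz; suc to fs; _<_ to _<ᶠ_; _<?_ to _<ᶠ?_)
import Data.Fin.Properties as FinP
open import Data.Vec using (Vec; []; _∷_; lookup; last; allFin)
import Data.Vec.Properties as VecP
open import Data.Vec.Relation.Unary.Any using (here; there; index)
import Data.Vec.Relation.Unary.Any as Any
open import Data.Vec.Relation.Unary.Any.Properties using (lookup-index)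
open import Data.Vec.Membership.Propositional using (_∈_; _∉_)
open import Data.Vec.Membership.Propositional.Properties using (∈-lookup; ∈-allFin⁺)
open import Data.Product using (_×_; Σ; _,_; proj₁; proj₂)
open import Data.Sum using (_⊎_; inj₁; inj₂; [_,_])
import Data.Sum as Sum
open import Data.Empty using (⊥; ⊥-elim)
open import Data.Unit using (⊤; tt)
open import Function.Base using (case_of_)
open import Function.Bundles using (_⇔_; mk⇔)
open import Relation.Nullary using (¬_; Dec; yes; no)
open import Relation.Nullary.Decidable using (_×-dec_; _⊎-dec_; _→-dec_; ¬?)
open import Relation.Binary.PropositionalEquality hiding ([_])
open import Relation.Binary.Construct.Closure.ReflexiveTransitive using (Star; ε; _◅_; _◅◅_; gmap)
open import Relation.Binary using (tri<; tri≈; tri>)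
open import Algebra.Properties.CommutativeSemigroup +-commutativeSemigroup using (x∙yz≈y∙xz)

module _ {A : Set} where

  Precedes : ∀ {m} → Vec A m → A → A → Set
  Precedes []       a b = ⊥
  Precedes (c ∷ xs) a b = (c ≡ a × b ∈ xs) ⊎ Precedes xs a b

  Distinct : ∀ {m} → Vec A m → Set
  Distinct []       = ⊤
  Distinct (c ∷ xs) = c ∉ xs × Distinct xs

  precedes-∈ˡ : ∀ {m} {xs : Vec A m} {a b} → Precedes xs a b → a ∈ xs
  precedes-∈ˡ {xs = c ∷ xs} (inj₁ (refl , _)) = here refl
  precedes-∈ˡ {xs = c ∷ xs} (inj₂ p)          = there (precedes-∈ˡ p)

  precedes-∈ʳ : ∀ {m} {xs : Vec A m} {a b} → Precedes xs a b → b ∈ xs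
  precedes-∈ʳ {xs = c ∷ xs} (inj₁ (_ , b∈xs)) = there b∈xs
  precedes-∈ʳ {xs = c ∷ xs} (inj₂ p)          = there (precedes-∈ʳ p)

  precedes-irrefl : ∀ {m} {xs : Vec A m} {a} → Distinct xs → ¬ Precedes xs a a
  precedes-irrefl {xs = c ∷ xs} (c∉xs , _) (inj₁ (refl , c∈xs)) = c∉xs c∈xs
  precedes-irrefl {xs = c ∷ xs} (_ , d)    (inj₂ p)             = precedes-irrefl d p

  precedes-≢ : ∀ {m} {xs : Vec A m} {a b} → Distinct xs → Precedes xs a b → a ≢ b
  precedes-≢ d p refl = precedes-irrefl d p

  precedes-asym : ∀ {m} {xs : Vec A m} {a b} → Distinct xs → Precedes xs a b → ¬ Precedes xs b a
  precedes-asym {xs = c ∷ xs} (c∉xs , _) (inj₁ (refl , b∈xs)) (inj₁ (refl , _)) = c∉xs b∈xs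
  precedes-asym {xs = c ∷ xs} (c∉xs , _) (inj₁ (refl , _))    (inj₂ q)          = c∉xs (precedes-∈ʳ q)
  precedes-asym {xs = c ∷ xs} (c∉xs , _) (inj₂ p)             (inj₁ (refl , _)) = c∉xs (precedes-∈ʳ p)
  precedes-asym {xs = c ∷ xs} (_ , d)    (inj₂ p)             (inj₂ q)          = precedes-asym d p q

  precedes-trans : ∀ {m} {xs : Vec A m} {a b e} → Distinct xs →
                   Precedes xs a b → Precedes xs b e → Precedes xs a e
  precedes-trans {xs = c ∷ xs} (c∉xs , _) (inj₁ (refl , b∈xs)) (inj₁ (refl , _)) = ⊥-elim (c∉xs b∈xs)
  precedes-trans {xs = c ∷ xs} _          (inj₁ (refl , _))    (inj₂ q)          = inj₁ (refl , precedes-∈ʳ q)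
  precedes-trans {xs = c ∷ xs} (c∉xs , _) (inj₂ p)             (inj₁ (refl , _)) = ⊥-elim (c∉xs (precedes-∈ʳ p))
  precedes-trans {xs = c ∷ xs} (_ , d)    (inj₂ p)             (inj₂ q)          = inj₂ (precedes-trans d p q)

  precedes-total : ∀ {m} {xs : Vec A m} {a b} → a ∈ xs → b ∈ xs → a ≢ b →
                   Precedes xs a b ⊎ Precedes xs b a
  precedes-total (here refl) (here refl) a≢b = ⊥-elim (a≢b refl)
  precedes-total (here refl) (there b∈xs) _  = inj₁ (inj₁ (refl , b∈xs))
  precedes-total (there a∈xs) (here refl) _  = inj₂ (inj₁ (refl , a∈xs))
  precedes-total (there a∈xs) (there b∈xs) a≢b =
    Sum.map inj₂ inj₂ (precedes-total a∈xs b∈xs a≢b)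

  lookup-precedes : ∀ {m} (xs : Vec A m) {i j : Fin m} → toℕ i < toℕ j →
                    Precedes xs (lookup xs i) (lookup xs j)
  lookup-precedes (x ∷ xs) {fz}   {fs j} _         = inj₁ (refl , ∈-lookup j xs)
  lookup-precedes (x ∷ xs) {fs i} {fs j} (s≤s i<j) = inj₂ (lookup-precedes xs i<j)

  precedes⇒lookup : ∀ {m} (xs : Vec A m) {a b} → Precedes xs a b →
    Σ (Fin m) λ i → Σ (Fin m) λ j → toℕ i < toℕ j × lookup xs i ≡ a × lookup xs j ≡ b
  precedes⇒lookup (x ∷ xs) (inj₁ (refl , b∈xs)) =
    fz , fs (index b∈xs) , s≤s z≤n , refl , sym (lookup-index b∈xs)
  precedes⇒lookup (x ∷ xs) (inj₂ p) with precedes⇒lookup xs p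
  ... | i , j , i<j , eqᵢ , eqⱼ = fs i , fs j , s≤s i<j , eqᵢ , eqⱼ

  LookupInjective : ∀ {m} → Vec A m → Set
  LookupInjective {m} xs = ∀ (i j : Fin m) → lookup xs i ≡ lookup xs j → i ≡ j

  injective⇒distinct : ∀ {m} (xs : Vec A m) → LookupInjective xs → Distinct xs
  injective⇒distinct []       _   = tt
  injective⇒distinct (x ∷ xs) inj =
    (λ x∈xs → FinP.0≢1+n (inj fz (fs (index x∈xs)) (lookup-index x∈xs))) ,
    injective⇒distinct xs (λ i j e → FinP.suc-injective (inj (fs i) (fs j) e))

  distinct⇒injective : ∀ {m} (xs : Vec A m) → Distinct xs → LookupInjective xs
  distinct⇒injective (x ∷ xs) _          fz     fz     _ = refl
  distinct⇒injective (x ∷ xs) (x∉xs , _) fz     (fs j) e = ⊥-elim (x∉xs (subst (_∈ xs) (sym e) (∈-lookup j xs)))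
  distinct⇒injective (x ∷ xs) (x∉xs , _) (fs i) fz     e = ⊥-elim (x∉xs (subst (_∈ xs) e (∈-lookup i xs)))
  distinct⇒injective (x ∷ xs) (_ , d)    (fs i) (fs j) e = cong fs (distinct⇒injective xs d i j e)

  data Remove (c : A) : ∀ {m} → Vec A (suc m) → Vec A m → Set where
    remove-here  : ∀ {m} {zs : Vec A m} → Remove c (c ∷ zs) zs
    remove-there : ∀ {m} {q} {xs : Vec A (suc m)} {zs : Vec A m} →
                   Remove c xs zs → Remove c (q ∷ xs) (q ∷ zs)

  ∈⇒remove : ∀ {m} {xs : Vec A (suc m)} {c} → c ∈ xs → Σ (Vec A m) (Remove c xs)
  ∈⇒remove (here refl) = _ , remove-here
  ∈⇒remove {suc m} {q ∷ xs} (there c∈xs) with ∈⇒remove c∈xs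
  ... | zs , r = q ∷ zs , remove-there r

  remove-∈ : ∀ {m} {xs : Vec A (suc m)} {zs c} → Remove c xs zs → c ∈ xs
  remove-∈ remove-here      = here refl
  remove-∈ (remove-there r) = there (remove-∈ r)

  remove-∈⁺ : ∀ {m} {xs : Vec A (suc m)} {zs c a} → Remove c xs zs → a ∈ xs → a ≢ c → a ∈ zs
  remove-∈⁺ remove-here      a∈xs         a≢c = Any.tail a≢c a∈xs
  remove-∈⁺ (remove-there r) (here refl)  _   = here refl
  remove-∈⁺ (remove-there r) (there a∈xs) a≢c = there (remove-∈⁺ r a∈xs a≢c)

  remove-∈⁻ : ∀ {m} {xs : Vec A (suc m)} {zs c a} → Remove c xs zs → a ∈ zs → a ∈ xs
  remove-∈⁻ remove-here      a∈zs         = there a∈zs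
  remove-∈⁻ (remove-there r) (here refl)  = here refl
  remove-∈⁻ (remove-there r) (there a∈zs) = there (remove-∈⁻ r a∈zs)

  remove-distinct : ∀ {m} {xs : Vec A (suc m)} {zs c} → Remove c xs zs → Distinct xs → Distinct zs
  remove-distinct remove-here      (_ , d)    = d
  remove-distinct (remove-there r) (q∉xs , d) = (λ q∈zs → q∉xs (remove-∈⁻ r q∈zs)) , remove-distinct r d

  remove-∉ : ∀ {m} {xs : Vec A (suc m)} {zs c} → Remove c xs zs → Distinct xs → c ∉ zs
  remove-∉ remove-here      (c∉zs , _) = c∉zs
  remove-∉ (remove-there r) (q∉xs , _) (here refl)  = q∉xs (remove-∈ r)
  remove-∉ (remove-there r) (_ , d)    (there c∈zs) = remove-∉ r d c∈zs

  remove-precedes : ∀ {m} {xs : Vec A (suc m)} {zs c a b} → Remove c xs zs →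
                    Precedes xs a b → a ≢ c → b ≢ c → Precedes zs a b
  remove-precedes remove-here      (inj₁ (refl , _))    a≢c _   = ⊥-elim (a≢c refl)
  remove-precedes remove-here      (inj₂ p)             _   _   = p
  remove-precedes (remove-there r) (inj₁ (refl , b∈xs)) _   b≢c = inj₁ (refl , remove-∈⁺ r b∈xs b≢c)
  remove-precedes (remove-there r) (inj₂ p)             a≢c b≢c = inj₂ (remove-precedes r p a≢c b≢c)

module _ {n : ℕ} where

  _⋖_ : ∀ {m} → Vec (Fin n) m → Vec (Fin n) m → Set
  _⋖_ = SwapDesc _<ᶠ_

  _≼_ : ∀ {m} → Vec (Fin n) m → Vec (Fin n) m → Set
  _≼_ = Star _⋖_

  ⋖-∈⁺ : ∀ {m} {y x : Vec (Fin n) m} {a} → y ⋖ x → a ∈ y → a ∈ x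
  ⋖-∈⁺ (here _)  (here refl)          = there (here refl)
  ⋖-∈⁺ (here _)  (there (here refl))  = here refl
  ⋖-∈⁺ (here _)  (there (there a∈xs)) = there (there a∈xs)
  ⋖-∈⁺ (there s) (here refl)          = here refl
  ⋖-∈⁺ (there s) (there a∈ys)         = there (⋖-∈⁺ s a∈ys)

  Inversions⊆ : ∀ {m} → Vec (Fin n) m → Vec (Fin n) m → Set
  Inversions⊆ y x = ∀ {a b} → b <ᶠ a → Precedes y a b → Precedes x a b

  ⋖-inversion : ∀ {m} {y x : Vec (Fin n) m} → y ⋖ x → Inversions⊆ y x
  ⋖-inversion (here q<p) b<a (inj₁ (refl , here refl))   = ⊥-elim (<-asym q<p b<a)
  ⋖-inversion (here q<p) b<a (inj₁ (refl , there b∈xs))  = inj₂ (inj₁ (refl , b∈xs))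
  ⋖-inversion (here q<p) b<a (inj₂ (inj₁ (refl , b∈xs))) = inj₁ (refl , there b∈xs)
  ⋖-inversion (here q<p) b<a (inj₂ (inj₂ p))             = inj₂ (inj₂ p)
  ⋖-inversion (there s)  b<a (inj₁ (e , b∈ys))           = inj₁ (e , ⋖-∈⁺ s b∈ys)
  ⋖-inversion (there s)  b<a (inj₂ p)                    = inj₂ (⋖-inversion s b<a p)

  ≼-inversion : ∀ {m} {y x : Vec (Fin n) m} → y ≼ x → Inversions⊆ y x
  ≼-inversion ε       _   p = p
  ≼-inversion (s ◅ r) b<a p = ≼-inversion r b<a (⋖-inversion s b<a p)

  ≼-∷ : ∀ {m} {y x : Vec (Fin n) m} {c} → y ≼ x → (c ∷ y) ≼ (c ∷ x)
  ≼-∷ = gmap (_ ∷_) there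

  [_<ᶠ_] : Fin n → Fin n → ℕ
  [ c <ᶠ a ] with c <ᶠ? a
  ... | yes _ = 1
  ... | no _  = 0

  [<]≡1 : ∀ {c a} → c <ᶠ a → [ c <ᶠ a ] ≡ 1
  [<]≡1 {c} {a} c<a with c <ᶠ? a
  ... | yes _   = refl
  ... | no c≮a = ⊥-elim (c≮a c<a)

  [≮]≡0 : ∀ {c a} → ¬ c <ᶠ a → [ c <ᶠ a ] ≡ 0
  [≮]≡0 {c} {a} c≮a with c <ᶠ? a
  ... | yes c<a = ⊥-elim (c≮a c<a)
  ... | no _    = refl

  smaller : ∀ {m} → Fin n → Vec (Fin n) m → ℕ
  smaller a []       = 0
  smaller a (c ∷ xs) = [ c <ᶠ a ] + smaller a xs

  inversions : ∀ {m} → Vec (Fin n) m → ℕ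
  inversions []       = 0
  inversions (c ∷ xs) = smaller c xs + inversions xs

  ⋖-smaller : ∀ {m} {y x : Vec (Fin n) m} a → y ⋖ x → smaller a y ≡ smaller a x
  ⋖-smaller a (here {a = p} {b = q} {xs = xs} _) = x∙yz≈y∙xz [ q <ᶠ a ] [ p <ᶠ a ] (smaller a xs)
  ⋖-smaller a (there {c = c} s)                  = cong ([ c <ᶠ a ] +_) (⋖-smaller a s)

  ⋖-inversions : ∀ {m} {y x : Vec (Fin n) m} → y ⋖ x → inversions x ≡ suc (inversions y)
  ⋖-inversions (here {a = p} {b = q} {xs = xs} q<p)
    rewrite [<]≡1 q<p | [≮]≡0 (<-asym q<p) =
      cong suc (x∙yz≈y∙xz (smaller p xs) (smaller q xs) (inversions xs))
  ⋖-inversions (there {c = c} {ys = ys} {xs = xs} s)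
    rewrite ⋖-smaller c s | ⋖-inversions s = +-suc (smaller c xs) (inversions ys)

  ≼-inversions : ∀ {m} {y x : Vec (Fin n) m} → y ≼ x → inversions y ≤ inversions x
  ≼-inversions ε       = ≤-refl
  ≼-inversions (s ◅ r) = ≤-trans (<⇒≤ (≤-reflexive (sym (⋖-inversions s)))) (≼-inversions r)

  ≼-antisym : ∀ {m} {y x : Vec (Fin n) m} → y ≼ x → x ≼ y → y ≡ x
  ≼-antisym ε _ = refl
  ≼-antisym {y = y} (_◅_ {j = z} s r) r′ = ⊥-elim (<-irrefl refl (begin-strict
    inversions y <⟨ ≤-reflexive (sym (⋖-inversions s)) ⟩
    inversions z ≤⟨ ≼-inversions (r ◅◅ r′) ⟩
    inversions y ∎))
    where open ≤-Reasoning

  ≼-moveToFront : ∀ {m} {xs : Vec (Fin n) (suc m)} {zs c} → Remove c xs zs →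
                  (∀ {q} → Precedes xs q c → c <ᶠ q) → (c ∷ zs) ≼ xs
  ≼-moveToFront remove-here      _      = ε
  ≼-moveToFront (remove-there r) c<pre =
    here (c<pre (inj₁ (refl , remove-∈ r))) ◅ ≼-∷ (≼-moveToFront r (λ p → c<pre (inj₂ p)))

  SameElements : ∀ {m} → Vec (Fin n) m → Vec (Fin n) m → Set
  SameElements y x = (∀ {a} → a ∈ y → a ∈ x) × (∀ {a} → a ∈ x → a ∈ y)

  inversions⊆⇒≼ : ∀ {m} {y x : Vec (Fin n) m} → Distinct y → Distinct x →
                   SameElements y x → Inversions⊆ y x → y ≼ x
  inversions⊆⇒≼ {y = []} {[]} _ _ _ _ = ε
  inversions⊆⇒≼ {y = c ∷ y} {x} (c∉y , dy) dx (y⊆x , x⊆y) inv⊆ with ∈⇒remove (y⊆x (here refl))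
  ... | z , r = ≼-∷ y≼z ◅◅ ≼-moveToFront r c<pre
    where
    ≢c : ∀ {a} → a ∈ y → a ≢ c
    ≢c a∈y refl = c∉y a∈y

    c<pre : ∀ {q} → Precedes x q c → c <ᶠ q
    c<pre {q} p with FinP.<-cmp q c
    ... | tri> _ _ c<q = c<q
    ... | tri≈ _ q≡c _ = ⊥-elim (precedes-≢ dx p q≡c)
    ... | tri< q<c _ _ = ⊥-elim (precedes-asym dx p
            (inv⊆ q<c (inj₁ (refl , Any.tail (precedes-≢ dx p) (x⊆y (precedes-∈ˡ p))))))

    y≼z : y ≼ z
    y≼z = inversions⊆⇒≼ dy (remove-distinct r dx)
      ((λ a∈y → remove-∈⁺ r (y⊆x (there a∈y)) (≢c a∈y)) ,
       (λ a∈z → Any.tail (λ { refl → remove-∉ r dx a∈z }) (x⊆y (remove-∈⁻ r a∈z))))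
      (λ b<a p → remove-precedes r (inv⊆ b<a (inj₂ p)) (≢c (precedes-∈ˡ p)) (≢c (precedes-∈ʳ p)))

injective⇒∈ : ∀ {n} (xs : Vec (Fin n) n) → LookupInjective xs → ∀ a → a ∈ xs
injective⇒∈ {suc k} xs inj a with FinP.any? (λ i → lookup xs i FinP.≟ a)
... | yes (i , xsᵢ≡a) = subst (_∈ xs) xsᵢ≡a (∈-lookup i xs)
... | no a∉xs = ⊥-elim (<-irrefl refl (FinP.injective⇒≤ squeeze-injective))
  where
  squeeze : Fin (suc k) → Fin k
  squeeze i = punchOut {i = a} (λ e → a∉xs (i , sym e))
  squeeze-injective : ∀ {i j} → squeeze i ≡ squeeze j → i ≡ j
  squeeze-injective {i} {j} e =
    inj i j (FinP.punchOut-injective {i = a} (λ e′ → a∉xs (i , sym e′)) (λ e′ → a∉xs (j , sym e′)) e)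

Permutation : ∀ {n} → Word n → Set
Permutation x = Distinct x × (∀ a → a ∈ x)

inAv⇒permutation : ∀ {n} (x : Word n) → InAv x → Permutation x
inAv⇒permutation x (inj , _) = injective⇒distinct x inj , injective⇒∈ x inj

permutations-≼ : ∀ {n} {y x : Word n} → Permutation y → Permutation x → Inversions⊆ y x → y ≼ x
permutations-≼ (dy , ∈y) (dx , ∈x) = inversions⊆⇒≼ dy dx ((λ {a} _ → ∈x a) , (λ {a} _ → ∈y a))

module InsertionSort {A : Set} (_≺_ : A → A → Set) (_≺?_ : ∀ a b → Dec (a ≺ b))
    (≺-trans : ∀ {a b c} → a ≺ b → b ≺ c → a ≺ c)
    (≺-asym : ∀ {a b} → a ≺ b → ¬ b ≺ a)
    (≺-connex : ∀ {a b} → a ≢ b → ¬ a ≺ b → b ≺ a) where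

  insert : ∀ {m} → A → Vec A m → Vec A (suc m)
  insert c []      = c ∷ []
  insert c (d ∷ v) with c ≺? d
  ... | yes _ = c ∷ d ∷ v
  ... | no _  = d ∷ insert c v

  sort : ∀ {m} → Vec A m → Vec A m
  sort []      = []
  sort (c ∷ v) = insert c (sort v)

  Sorted : ∀ {m} → Vec A m → Set
  Sorted []      = ⊤
  Sorted (d ∷ v) = (∀ {a} → a ∈ v → d ≺ a) × Sorted v

  insert-∈⁻ : ∀ {m} c (v : Vec A m) {a} → a ∈ insert c v → a ≡ c ⊎ a ∈ v
  insert-∈⁻ c []      (here refl) = inj₁ refl
  insert-∈⁻ c (d ∷ v) p with c ≺? d
  insert-∈⁻ c (d ∷ v) (here refl) | yes _ = inj₁ refl
  insert-∈⁻ c (d ∷ v) (there p)   | yes _ = inj₂ p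
  insert-∈⁻ c (d ∷ v) (here refl) | no _  = inj₂ (here refl)
  insert-∈⁻ c (d ∷ v) (there p)   | no _  = Sum.map₂ there (insert-∈⁻ c v p)

  insert-∈ : ∀ {m} c (v : Vec A m) → c ∈ insert c v
  insert-∈ c []      = here refl
  insert-∈ c (d ∷ v) with c ≺? d
  ... | yes _ = here refl
  ... | no _  = there (insert-∈ c v)

  insert-∈⁺ : ∀ {m} c (v : Vec A m) {a} → a ∈ v → a ∈ insert c v
  insert-∈⁺ c (d ∷ v) p with c ≺? d
  ... | yes _ = there p
  insert-∈⁺ c (d ∷ v) (here refl) | no _ = here refl
  insert-∈⁺ c (d ∷ v) (there p)   | no _ = there (insert-∈⁺ c v p)

  insert-distinct : ∀ {m} c (v : Vec A m) → c ∉ v → Distinct v → Distinct (insert c v)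
  insert-distinct c []      _   _ = (λ ()) , tt
  insert-distinct c (d ∷ v) c∉v (d∉v , dv) with c ≺? d
  ... | yes _ = c∉v , d∉v , dv
  ... | no _  = (λ p → [ (λ { refl → c∉v (here refl) }) , d∉v ] (insert-∈⁻ c v p)) ,
                insert-distinct c v (λ p → c∉v (there p)) dv

  insert-sorted : ∀ {m} c (v : Vec A m) → c ∉ v → Sorted v → Sorted (insert c v)
  insert-sorted c []      _   _ = (λ ()) , tt
  insert-sorted c (d ∷ v) c∉v (d≺v , sv) with c ≺? d
  ... | yes c≺d = (λ { (here refl) → c≺d ; (there p) → ≺-trans c≺d (d≺v p) }) , d≺v , sv
  ... | no c⊀d  = (λ p → [ (λ { refl → ≺-connex (λ { refl → c∉v (here refl) }) c⊀d }) , d≺v ]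
                            (insert-∈⁻ c v p)) ,
                  insert-sorted c v (λ p → c∉v (there p)) sv

  sort-∈⁻ : ∀ {m} (v : Vec A m) {a} → a ∈ sort v → a ∈ v
  sort-∈⁻ (c ∷ v) p = [ (λ { refl → here refl }) , (λ q → there (sort-∈⁻ v q)) ] (insert-∈⁻ c (sort v) p)

  sort-∈⁺ : ∀ {m} (v : Vec A m) {a} → a ∈ v → a ∈ sort v
  sort-∈⁺ (c ∷ v) (here refl) = insert-∈ c (sort v)
  sort-∈⁺ (c ∷ v) (there p)   = insert-∈⁺ c (sort v) (sort-∈⁺ v p)

  sort-distinct : ∀ {m} (v : Vec A m) → Distinct v → Distinct (sort v)
  sort-distinct []      _          = tt
  sort-distinct (c ∷ v) (c∉v , dv) = insert-distinct c (sort v) (λ p → c∉v (sort-∈⁻ v p)) (sort-distinct v dv)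

  sort-sorted : ∀ {m} (v : Vec A m) → Distinct v → Sorted (sort v)
  sort-sorted []      _          = tt
  sort-sorted (c ∷ v) (c∉v , dv) = insert-sorted c (sort v) (λ p → c∉v (sort-∈⁻ v p)) (sort-sorted v dv)

  sorted-precedes⇒≺ : ∀ {m} (v : Vec A m) → Sorted v → ∀ {a b} → Precedes v a b → a ≺ b
  sorted-precedes⇒≺ (d ∷ v) (d≺v , _)  (inj₁ (refl , b∈v)) = d≺v b∈v
  sorted-precedes⇒≺ (d ∷ v) (_ , sv)   (inj₂ p)            = sorted-precedes⇒≺ v sv p

  sorted-≺⇒precedes : ∀ {m} (v : Vec A m) → Sorted v → ∀ {a b} → a ∈ v → b ∈ v → a ≺ b → Precedes v a b
  sorted-≺⇒precedes v sv a∈v b∈v a≺b with precedes-total a∈v b∈v (λ { refl → ≺-asym a≺b a≺b })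
  ... | inj₁ p = p
  ... | inj₂ p = ⊥-elim (≺-asym a≺b (sorted-precedes⇒≺ v sv p))

record Nested (n : ℕ) (t : ℕ → ℕ) : Set where
  field
    inflationary : ∀ b → b ≤ t b
    bounded      : ∀ b → b < n → t b < n
    outside      : ∀ b → n ≤ b → t b ≡ b
    nested       : ∀ b a → b < a → a ≤ t b → t a ≤ t b
open Nested

-- The order in which the values appear in the permutation encoded by t.
Prec : (ℕ → ℕ) → ℕ → ℕ → Set
Prec t a b = (b < a × a ≤ t b) ⊎ (a < b × ¬ b ≤ t a)

Prec? : ∀ t a b → Dec (Prec t a b)
Prec? t a b = ((b <? a) ×-dec (a ≤? t b)) ⊎-dec ((a <? b) ×-dec ¬? (b ≤? t a))

Prec-asym : ∀ {t a b} → Prec t a b → ¬ Prec t b a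
Prec-asym (inj₁ (b<a , _))    (inj₁ (a<b , _))    = <-asym a<b b<a
Prec-asym (inj₁ (_ , a≤tb))   (inj₂ (_ , a≰tb))   = a≰tb a≤tb
Prec-asym (inj₂ (_ , b≰ta))   (inj₁ (_ , b≤ta))   = b≰ta b≤ta
Prec-asym (inj₂ (a<b , _))    (inj₂ (b<a , _))    = <-asym a<b b<a

Prec-connex : ∀ {t a b} → a ≢ b → ¬ Prec t a b → Prec t b a
Prec-connex {t} {a} {b} a≢b a⊀b with <-cmp a b
... | tri≈ _ a≡b _ = ⊥-elim (a≢b a≡b)
... | tri< a<b _ _ with b ≤? t a
...   | yes b≤ta = inj₁ (a<b , b≤ta)
...   | no b≰ta  = ⊥-elim (a⊀b (inj₂ (a<b , b≰ta)))
Prec-connex {t} {a} {b} a≢b a⊀b | tri> _ _ b<a with a ≤? t b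
...   | yes a≤tb = ⊥-elim (a⊀b (inj₁ (b<a , a≤tb)))
...   | no a≰tb  = inj₂ (b<a , a≰tb)

module _ {n t} (N : Nested n t) where

  Prec-trans : ∀ {a b c} → Prec t a b → Prec t b c → Prec t a c
  Prec-trans {a} {b} {c} (inj₁ (b<a , a≤tb)) (inj₁ (c<b , b≤tc)) =
    inj₁ (<-trans c<b b<a , ≤-trans a≤tb (nested N c b c<b b≤tc))
  Prec-trans {a} {b} {c} (inj₁ (b<a , a≤tb)) (inj₂ (b<c , c≰tb)) with <-cmp a c
  ... | tri< a<c _ _    = inj₂ (a<c , λ c≤ta → c≰tb (≤-trans c≤ta (nested N b a b<a a≤tb)))
  ... | tri≈ _ refl _   = ⊥-elim (c≰tb a≤tb)
  ... | tri> _ _ c<a    = ⊥-elim (c≰tb (≤-trans (<⇒≤ c<a) a≤tb))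
  Prec-trans {a} {b} {c} (inj₂ (a<b , b≰ta)) (inj₁ (c<b , b≤tc)) with <-cmp a c
  ... | tri< a<c _ _    = inj₂ (a<c , λ c≤ta → b≰ta (≤-trans b≤tc (nested N a c a<c c≤ta)))
  ... | tri≈ _ refl _   = ⊥-elim (b≰ta b≤tc)
  ... | tri> _ _ c<a    = inj₁ (c<a , ≤-trans (<⇒≤ a<b) b≤tc)
  Prec-trans (inj₂ (a<b , b≰ta)) (inj₂ (b<c , c≰tb)) =
    inj₂ (<-trans a<b b<c , λ c≤ta → b≰ta (≤-trans (<⇒≤ b<c) c≤ta))

record Encodes {n} (x : Word n) (t : ℕ → ℕ) : Set where
  field
    precedes⇒≤ : ∀ {a b} → b <ᶠ a → Precedes x a b → toℕ a ≤ t (toℕ b)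
    ≤⇒precedes : ∀ a b → b <ᶠ a → toℕ a ≤ t (toℕ b) → Precedes x a b
open Encodes

encodes⇒avoids312 : ∀ {n} {x : Word n} {t} → Distinct x → Encodes x t → Avoids312 x
encodes⇒avoids312 {x = x} dx E i j k i<j j<k (xⱼ<xₖ , xₖ<xᵢ) =
  precedes-asym dx (lookup-precedes x j<k)
    (≤⇒precedes E _ _ xⱼ<xₖ (≤-trans (<⇒≤ xₖ<xᵢ)
      (precedes⇒≤ E (<-trans xⱼ<xₖ xₖ<xᵢ) (lookup-precedes x i<j))))

module Decode {n t} (N : Nested n t) where
  open InsertionSort (λ (a b : Fin n) → Prec t (toℕ a) (toℕ b)) (λ a b → Prec? t (toℕ a) (toℕ b))
    (Prec-trans N) (Prec-asym {t}) (λ a≢b → Prec-connex {t} (λ e → a≢b (FinP.toℕ-injective e)))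

  allFin-distinct : Distinct (allFin n)
  allFin-distinct = injective⇒distinct (allFin n)
    (λ i j e → trans (sym (VecP.lookup-allFin i)) (trans e (VecP.lookup-allFin j)))

  decode : Word n
  decode = sort (allFin n)

  decode-distinct : Distinct decode
  decode-distinct = sort-distinct (allFin n) allFin-distinct

  decode-∈ : ∀ a → a ∈ decode
  decode-∈ a = sort-∈⁺ (allFin n) (∈-allFin⁺ a)

  decode-sorted : Sorted decode
  decode-sorted = sort-sorted (allFin n) allFin-distinct

  decode-encodes : Encodes decode t
  precedes⇒≤ decode-encodes b<a p =
    [ proj₂ , (λ (a<b , _) → ⊥-elim (<-asym b<a a<b)) ] (sorted-precedes⇒≺ decode decode-sorted p)
  ≤⇒precedes decode-encodes a b b<a a≤tb =
    sorted-≺⇒precedes decode decode-sorted (decode-∈ a) (decode-∈ b) (inj₁ (b<a , a≤tb))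

  decode-inAv : InAv decode
  decode-inAv = distinct⇒injective decode decode-distinct ,
                encodes⇒avoids312 decode-distinct decode-encodes

  decode-permutation : Permutation decode
  decode-permutation = decode-distinct , decode-∈
open Decode using (decode; decode-inAv; decode-encodes; decode-permutation)

∀Fin⇒∀< : ∀ {n} (P : ℕ → Set) → (∀ (i : Fin n) → P (toℕ i)) → ∀ k → k < n → P k
∀Fin⇒∀< P h k k<n = subst P (FinP.toℕ-fromℕ< k<n) (h (fromℕ< k<n))

nested-from-Fin : ∀ {n} {t : ℕ → ℕ} → (∀ b → n ≤ b → t b ≡ b) → (∀ b → b < n → t b < n) →
  (∀ (b a : Fin n) → b <ᶠ a → toℕ a ≤ t (toℕ b) → t (toℕ a) ≤ t (toℕ b)) →
  ∀ b a → b < a → a ≤ t b → t a ≤ t b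
nested-from-Fin {n} {t} out bnd nested-Fin b a b<a a≤tb with b <? n
... | no b≮n = ⊥-elim (<-irrefl refl (<-≤-trans b<a (≤-trans a≤tb (≤-reflexive (out b (≮⇒≥ b≮n))))))
... | yes b<n with a<n ← ≤-<-trans a≤tb (bnd b b<n) with nested-Fin (fromℕ< b<n) (fromℕ< a<n)
...   | h rewrite FinP.toℕ-fromℕ< b<n | FinP.toℕ-fromℕ< a<n = h b<a a≤tb

module _ {n : ℕ} where

  top : ∀ {m} → Vec (Fin n) m → ℕ → ℕ
  top []       k = k
  top (c ∷ xs) k with toℕ c ≟ k
  ... | yes _ = k
  ... | no _ with k <? toℕ c
  ...   | yes _ = toℕ c ⊔ top xs k
  ...   | no _  = top xs k

  top-inflationary : ∀ {m} (xs : Vec (Fin n) m) k → k ≤ top xs k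
  top-inflationary []       k = ≤-refl
  top-inflationary (c ∷ xs) k with toℕ c ≟ k
  ... | yes _ = ≤-refl
  ... | no _ with k <? toℕ c
  ...   | yes _ = ≤-trans (top-inflationary xs k) (m≤n⊔m (toℕ c) (top xs k))
  ...   | no _  = top-inflationary xs k

  top-outside : ∀ {m} (xs : Vec (Fin n) m) k → n ≤ k → top xs k ≡ k
  top-outside []       k _   = refl
  top-outside (c ∷ xs) k n≤k with toℕ c ≟ k
  ... | yes _ = refl
  ... | no _ with k <? toℕ c
  ...   | yes k<c = ⊥-elim (<-irrefl refl (<-≤-trans (FinP.toℕ<n c) (≤-trans n≤k (<⇒≤ k<c))))
  ...   | no _    = top-outside xs k n≤k

  precedes⇒≤top : ∀ {m} (xs : Vec (Fin n) m) → Distinct xs → ∀ {a b} → b <ᶠ a →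
                  Precedes xs a b → toℕ a ≤ top xs (toℕ b)
  precedes⇒≤top (c ∷ xs) (c∉xs , dxs) {a} {b} b<a p with toℕ c ≟ toℕ b | p
  ... | yes c≡b | inj₁ (refl , _) = ⊥-elim (<-irrefl (sym c≡b) b<a)
  ... | yes c≡b | inj₂ q = ⊥-elim (c∉xs (subst (_∈ xs) (sym (FinP.toℕ-injective c≡b)) (precedes-∈ʳ q)))
  ... | no _    | _ with toℕ b <? toℕ c | p
  ...   | yes _   | inj₁ (refl , _) = m≤m⊔n (toℕ c) _
  ...   | yes _   | inj₂ q = ≤-trans (precedes⇒≤top xs dxs b<a q) (m≤n⊔m (toℕ c) _)
  ...   | no b≮c  | inj₁ (refl , _) = ⊥-elim (b≮c b<a)
  ...   | no _    | inj₂ q = precedes⇒≤top xs dxs b<a q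

  TopWitness : ∀ {m} → Vec (Fin n) m → Fin n → Set
  TopWitness xs b = top xs (toℕ b) ≡ toℕ b ⊎
    Σ (Fin n) λ a → toℕ a ≡ top xs (toℕ b) × Precedes xs a b × b <ᶠ a

  top-witness : ∀ {m} (xs : Vec (Fin n) m) → ∀ {b} → b ∈ xs → TopWitness xs b
  top-witness (c ∷ xs) {b} b∈ with toℕ c ≟ toℕ b
  ... | yes _ = inj₁ refl
  ... | no c≢b with Any.tail (λ { refl → c≢b refl }) b∈
  ...   | b∈xs with toℕ b <? toℕ c | top-witness xs b∈xs
  ...     | no _    | inj₁ e                 = inj₁ e
  ...     | no _    | inj₂ (a , e , p , b<a) = inj₂ (a , e , inj₂ p , b<a)
  ...     | yes b<c | inj₁ e =
            inj₂ (c , sym (trans (cong (toℕ c ⊔_) e) (m≥n⇒m⊔n≡m (<⇒≤ b<c))) , inj₁ (refl , b∈xs) , b<c)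
  ...     | yes b<c | inj₂ (a , e , p , b<a) with ⊔-sel (toℕ c) (top xs (toℕ b))
  ...       | inj₁ e′ = inj₂ (c , sym e′ , inj₁ (refl , b∈xs) , b<c)
  ...       | inj₂ e′ = inj₂ (a , trans e (sym e′) , inj₂ p , b<a)

  avoids312-precedes : ∀ {x : Word n} → LookupInjective x → Avoids312 x → ∀ {p q r} →
                       Precedes x p q → Precedes x q r → q <ᶠ r → r <ᶠ p → ⊥
  avoids312-precedes {x} inj av pq qr q<r r<p with precedes⇒lookup x pq | precedes⇒lookup x qr
  ... | i , j , i<j , refl , refl | j′ , k , j′<k , xⱼ′≡xⱼ , refl with inj j′ j xⱼ′≡xⱼ
  ... | refl = av i j k i<j j′<k (q<r , r<p)

  module _ (x : Word n) (x∈Av : InAv x) where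
    private
      inj = proj₁ x∈Av
      dx  = injective⇒distinct x inj
      ∈x  = injective⇒∈ x inj

    top-encodes : Encodes x (top x)
    precedes⇒≤ top-encodes = precedes⇒≤top x dx
    ≤⇒precedes top-encodes a b b<a a≤tb with top-witness x (∈x b)
    ... | inj₁ tb≡b = ⊥-elim (<-irrefl refl (<-≤-trans b<a (≤-trans a≤tb (≤-reflexive tb≡b))))
    ... | inj₂ (a′ , a′≡tb , a′b , _) with a FinP.≟ a′
    ...   | yes refl = a′b
    ...   | no a≢a′ with precedes-total (∈x a) (∈x b) (λ { refl → <-irrefl refl b<a })
    ...     | inj₁ ab = ab
    ...     | inj₂ ba = ⊥-elim (avoids312-precedes inj (proj₂ x∈Av) a′b ba b<a
                  (≤∧≢⇒< (≤-trans a≤tb (≤-reflexive (sym a′≡tb))) (λ e → a≢a′ (FinP.toℕ-injective e))))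

    top-nested : Nested n (top x)
    inflationary top-nested = top-inflationary x
    outside      top-nested = top-outside x
    bounded      top-nested = ∀Fin⇒∀< (λ b → top x b < n) bounded-Fin
      where
      bounded-Fin : ∀ b → top x (toℕ b) < n
      bounded-Fin b with top-witness x (∈x b)
      ... | inj₁ tb≡b          = subst (_< n) (sym tb≡b) (FinP.toℕ<n b)
      ... | inj₂ (a , a≡tb , _) = subst (_< n) a≡tb (FinP.toℕ<n a)
    nested top-nested = nested-from-Fin {t = top x} (top-outside x) (bounded top-nested) nested-Fin
      where
      nested-Fin : ∀ (b a : Fin n) → b <ᶠ a → toℕ a ≤ top x (toℕ b) → top x (toℕ a) ≤ top x (toℕ b)
      nested-Fin b a b<a a≤tb with top-witness x (∈x a)
      ... | inj₁ ta≡a                      = ≤-trans (≤-reflexive ta≡a) a≤tb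
      ... | inj₂ (a′ , a′≡ta , a′a , a<a′) = ≤-trans (≤-reflexive (sym a′≡ta))
             (precedes⇒≤top x dx (<-trans b<a a<a′) (precedes-trans dx a′a (≤⇒precedes top-encodes a b b<a a≤tb)))

module LeastSearch (P : ℕ → Set) (P? : ∀ j → Dec (P j)) where

  least : ℕ → ℕ
  least zero    = zero
  least (suc k) with P? (least k)
  ... | yes _ = least k
  ... | no _  = suc k

  private
    least-spec : ∀ k → least k ≤ k × (∀ {j} → j < least k → ¬ P j) × (∀ {j} → j ≤ k → P j → P (least k))
    least-spec zero = z≤n , (λ ()) , λ { z≤n Pj → Pj }
    least-spec (suc k) with least-spec k | P? (least k)
    ... | ≤k , below , found | yes P-least = m≤n⇒m≤1+n ≤k , below , λ _ _ → P-least
    ... | ≤k , below , found | no ¬P-least =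
          ≤-refl , (λ j<sk Pj → ¬P-least (found (≤-pred j<sk) Pj)) , found′
      where
      found′ : ∀ {j} → j ≤ suc k → P j → P (suc k)
      found′ j≤sk Pj with m≤n⇒m<n∨m≡n j≤sk
      ... | inj₁ j<sk = ⊥-elim (¬P-least (found (≤-pred j<sk) Pj))
      ... | inj₂ refl = Pj

  least≤ : ∀ k → least k ≤ k
  least≤ k = proj₁ (least-spec k)

  <least⇒¬P : ∀ k {j} → j < least k → ¬ P j
  <least⇒¬P k = proj₁ (proj₂ (least-spec k))

  P-least : ∀ k {j} → j ≤ k → P j → P (least k)
  P-least k = proj₂ (proj₂ (least-spec k))

PrevCandidate : (ℕ → ℕ) → ℕ → ℕ → Set
PrevCandidate t b a = b < a × t b ≤ t a

-- Searching up to t b suffices: t b itself is a candidate whenever b < t b.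
prev : (ℕ → ℕ) → ℕ → ℕ
prev t b = LeastSearch.least (PrevCandidate t b) (λ a → (b <? a) ×-dec (t b ≤? t a)) (t b)

module _ {n t} (N : Nested n t) where

  <top⇒<n : ∀ {b} → b < t b → b < n
  <top⇒<n {b} b<tb with b <? n
  ... | yes b<n = b<n
  ... | no b≮n  = ⊥-elim (<-irrefl (sym (outside N b (≮⇒≥ b≮n))) b<tb)

  module _ {b} (b<tb : b < t b) where
    private
      open LeastSearch (PrevCandidate t b) (λ a → (b <? a) ×-dec (t b ≤? t a))

      prev-candidate : PrevCandidate t b (prev t b)
      prev-candidate = P-least (t b) ≤-refl (b<tb , inflationary N (t b))

    b<prev : b < prev t b
    b<prev = proj₁ prev-candidate

    top≤top-prev : t b ≤ t (prev t b)
    top≤top-prev = proj₂ prev-candidate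

    prev≤top : prev t b ≤ t b
    prev≤top = least≤ (t b)

    prev<n : prev t b < n
    prev<n = ≤-<-trans prev≤top (bounded N b (<top⇒<n b<tb))

    top<top-before-prev : ∀ {j} → b < j → j < prev t b → t j < t b
    top<top-before-prev b<j j<prev = ≰⇒> (λ tb≤tj → <least⇒¬P (t b) j<prev (b<j , tb≤tj))

    top<prev-before-prev : ∀ {j} → b < j → j < prev t b → t j < prev t b
    top<prev-before-prev {j} b<j j<prev = ≰⇒> λ prev≤tj → <-irrefl refl (begin-strict
      t j            <⟨ top<top-before-prev b<j j<prev ⟩
      t b            ≤⟨ top≤top-prev ⟩
      t (prev t b)   ≤⟨ nested N j (prev t b) j<prev prev≤tj ⟩
      t j            ∎)
      where open ≤-Reasoning

    prev-unique : ∀ {g} → b < g → t b ≤ t g → (∀ {j} → b < j → j < g → t j < t b) → prev t b ≡ g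
    prev-unique {g} b<g tb≤tg before-g with <-cmp (prev t b) g
    ... | tri≈ _ prev≡g _ = prev≡g
    ... | tri< prev<g _ _ = ⊥-elim (<-irrefl refl (<-≤-trans (before-g b<prev prev<g) top≤top-prev))
    ... | tri> _ _ g<prev = ⊥-elim (<-irrefl refl (<-≤-trans (top<top-before-prev b<g g<prev) tb≤tg))

    0<prev : 0 < prev t b
    0<prev = <-≤-trans (s≤s z≤n) b<prev

    ≤pred-prev⇒<prev : ∀ {a} → a ≤ pred (prev t b) → a < prev t b
    ≤pred-prev⇒<prev = m≤pred[n]⇒suc[m]≤n {{>-nonZero 0<prev}}

    pred-prev<⇒prev≤ : ∀ {a} → pred (prev t b) < a → prev t b ≤ a
    pred-prev<⇒prev≤ {a} = subst (_≤ a) (suc-pred (prev t b) {{>-nonZero 0<prev}})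

    pred-prev<top : pred (prev t b) < t b
    pred-prev<top = <-≤-trans (≤pred-prev⇒<prev ≤-refl) prev≤top

infix 4 _⊑_ _≐_

_⊑_ : (ℕ → ℕ) → (ℕ → ℕ) → Set
s ⊑ t = ∀ k → s k ≤ t k

_≐_ : (ℕ → ℕ) → (ℕ → ℕ) → Set
s ≐ t = ∀ k → s k ≡ t k

agreeing : ∀ {s u : ℕ → ℕ} {b} → s b ≡ u b → (∀ {k} → k ≢ b → s k ≡ u k) → s ≐ u
agreeing {b = b} sb≡ub off k with k ≟ b
... | yes refl = sb≡ub
... | no k≢b   = off k≢b

popTop : (ℕ → ℕ) → ℕ → ℕ
popTop t b with b <? t b
... | yes _ = pred (prev t b)
... | no _  = b

lowerAt : (ℕ → ℕ) → ℕ → ℕ → ℕ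
lowerAt t b k with k ≟ b
... | yes _ = pred (prev t b)
... | no _  = t k

popTop-< : ∀ t {b} → b < t b → popTop t b ≡ pred (prev t b)
popTop-< t {b} b<tb with b <? t b
... | yes _   = refl
... | no b≮tb = ⊥-elim (b≮tb b<tb)

popTop-≮ : ∀ t {b} → ¬ b < t b → popTop t b ≡ b
popTop-≮ t {b} b≮tb with b <? t b
... | yes b<tb = ⊥-elim (b≮tb b<tb)
... | no _     = refl

lowerAt-at : ∀ t b → lowerAt t b b ≡ pred (prev t b)
lowerAt-at t b with b ≟ b
... | yes _   = refl
... | no b≢b = ⊥-elim (b≢b refl)

lowerAt-off : ∀ t {b k} → k ≢ b → lowerAt t b k ≡ t k
lowerAt-off t {b} {k} k≢b with k ≟ b
... | yes k≡b = ⊥-elim (k≢b k≡b)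
... | no _    = refl

module _ {n t} (N : Nested n t) where

  popTop⊑top : popTop t ⊑ t
  popTop⊑top k with k <? t k
  ... | yes k<tk = ≤-trans pred[n]≤n (prev≤top N k<tk)
  ... | no _     = inflationary N k

  popTop-nested : Nested n (popTop t)
  inflationary popTop-nested k with k <? t k
  ... | yes k<tk = <⇒≤pred (b<prev N k<tk)
  ... | no _     = ≤-refl
  bounded popTop-nested k k<n = ≤-<-trans (popTop⊑top k) (bounded N k k<n)
  outside popTop-nested k n≤k = popTop-≮ t (λ k<tk → <⇒≱ (<top⇒<n N k<tk) n≤k)
  nested popTop-nested b a b<a a≤pb with b <? t b
  ... | no _     = ⊥-elim (<-irrefl refl (<-≤-trans b<a a≤pb))
  ... | yes b<tb = <⇒≤pred (≤-<-trans (popTop⊑top a)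
                     (top<prev-before-prev N b<tb b<a (≤pred-prev⇒<prev N b<tb a≤pb)))

  module _ {b} (b<tb : b < t b) where

    lowerAt⊑top : lowerAt t b ⊑ t
    lowerAt⊑top k with k ≟ b
    ... | yes refl = <⇒≤ (pred-prev<top N b<tb)
    ... | no _     = ≤-refl

    lowerAt-nested : Nested n (lowerAt t b)
    inflationary lowerAt-nested k with k ≟ b
    ... | yes refl = <⇒≤pred (b<prev N b<tb)
    ... | no _     = inflationary N k
    bounded lowerAt-nested k k<n = ≤-<-trans (lowerAt⊑top k) (bounded N k k<n)
    outside lowerAt-nested k n≤k with k ≟ b
    ... | yes refl = ⊥-elim (<⇒≱ (<top⇒<n N b<tb) n≤k)
    ... | no _     = outside N k n≤k
    nested lowerAt-nested k a k<a a≤lk with k ≟ b | a ≟ b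
    ... | yes refl | yes refl = ⊥-elim (<-irrefl refl k<a)
    ... | yes refl | no _     = <⇒≤pred (top<prev-before-prev N b<tb k<a (≤pred-prev⇒<prev N b<tb a≤lk))
    ... | no _     | yes refl = ≤-trans (<⇒≤ (pred-prev<top N b<tb)) (nested N k b k<a a≤lk)
    ... | no _     | no _     = nested N k a k<a a≤lk

    lowerAt-between : ∀ {s} → Nested n s → lowerAt t b ⊑ s → s ⊑ t → s ≐ lowerAt t b ⊎ s ≐ t
    lowerAt-between {s} S lo hi with s b ≟ lowerAt t b b | s b ≟ t b
    ... | yes sb≡lb | _        = inj₁ (agreeing sb≡lb λ k≢b → ≤-antisym (≤-trans (hi _) (≤-reflexive (sym (lowerAt-off t k≢b)))) (lo _))
    ... | no _      | yes sb≡tb = inj₂ (agreeing sb≡tb λ k≢b → ≤-antisym (hi _) (≤-trans (≤-reflexive (sym (lowerAt-off t k≢b))) (lo _)))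
    ... | no sb≢lb  | no sb≢tb  = ⊥-elim (<-irrefl refl (begin-strict
          s (prev t b)  ≤⟨ nested S b (prev t b) (b<prev N b<tb) prev≤sb ⟩
          s b           <⟨ ≤∧≢⇒< (hi b) sb≢tb ⟩
          t b           ≤⟨ top≤top-prev N b<tb ⟩
          t (prev t b)  ≡⟨ sym (lowerAt-off t prev≢b) ⟩
          lowerAt t b (prev t b) ≤⟨ lo (prev t b) ⟩
          s (prev t b)  ∎))
      where
      open ≤-Reasoning
      prev≢b : prev t b ≢ b
      prev≢b e = <-irrefl (sym e) (b<prev N b<tb)
      prev≤sb : prev t b ≤ s b
      prev≤sb = pred-prev<⇒prev≤ N b<tb
        (≤∧≢⇒< (subst (_≤ s b) (lowerAt-at t b) (lo b)) (λ e → sb≢lb (sym (trans (lowerAt-at t b) e))))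

  popTop⊑lowerAt : ∀ {b} → b < t b → popTop t ⊑ lowerAt t b
  popTop⊑lowerAt {b} b<tb k with k ≟ b
  ... | yes refl = ≤-reflexive (popTop-< t b<tb)
  ... | no k≢b   = popTop⊑top k

  ⊑popTop : ∀ {s} → s ⊑ t → (∀ {b} → b < t b → s ⊑ lowerAt t b) → s ⊑ popTop t
  ⊑popTop {s} s⊑t s⊑lowerAt k with k <? t k
  ... | yes k<tk = ≤-trans (s⊑lowerAt k<tk k) (≤-reflexive (lowerAt-at t k))
  ... | no k≮tk  = ≤-trans (s⊑t k) (≮⇒≥ k≮tk)

greatest-below : (P : ℕ → Set) → (∀ j → Dec (P j)) → ∀ {N k} → k < N → P k →
                 Σ ℕ λ r → P r × r < N × (∀ {j} → r < j → j < N → ¬ P j)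
greatest-below P P? {suc N} k<sN Pk with P? N
... | yes PN = N , PN , ≤-refl , λ N<j j<sN _ → <-irrefl refl (<-≤-trans N<j (≤-pred j<sN))
... | no ¬PN with m≤n⇒m<n∨m≡n (≤-pred k<sN)
...   | inj₂ refl = ⊥-elim (¬PN Pk)
...   | inj₁ k<N with greatest-below P P? k<N Pk
...     | r , Pr , r<N , above = r , Pr , m≤n⇒m≤1+n r<N , λ {j} r<j j<sN Pj → case j ≟ N of λ where
          (yes refl) → ¬PN Pj
          (no j≢N)   → above r<j (≤∧≢⇒< (≤-pred j<sN) j≢N) Pj

below-lowerAt : ∀ {n s t} → Nested n s → Nested n t → s ⊑ t → ∀ {k} → s k < t k →
                Σ ℕ λ b → Σ (b < t b) λ b<tb → s ⊑ lowerAt t b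
below-lowerAt {n} {s} {t} S N s⊑t {k} sk<tk with greatest-below (λ j → s j < t j) (λ j → s j <? t j) k<n sk<tk
  where
  k<n : k < n
  k<n = <top⇒<n N (≤-<-trans (inflationary S k) sk<tk)
... | b , sb<tb , _ , above = b , b<tb , s⊑lowerAt
  where
  b<tb : b < t b
  b<tb = ≤-<-trans (inflationary S b) sb<tb
  s⊑lowerAt : s ⊑ lowerAt t b
  s⊑lowerAt j with j ≟ b
  ... | no j≢b   = s⊑t j
  ... | yes refl = <⇒≤pred (≰⇒> λ prev≤sb → above (b<prev N b<tb) (prev<n N b<tb) (begin-strict
        s (prev t b)  ≤⟨ nested S b (prev t b) (b<prev N b<tb) prev≤sb ⟩
        s b           <⟨ sb<tb ⟩
        t b           ≤⟨ top≤top-prev N b<tb ⟩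
        t (prev t b)  ∎))
    where open ≤-Reasoning

encodes-cong : ∀ {n} {x : Word n} {s t} → s ≐ t → Encodes x s → Encodes x t
precedes⇒≤ (encodes-cong s≐t E) {b = b} b<a p = subst (_ ≤_) (s≐t (toℕ b)) (precedes⇒≤ E b<a p)
≤⇒precedes (encodes-cong s≐t E) a b b<a a≤tb = ≤⇒precedes E a b b<a (subst (_ ≤_) (sym (s≐t (toℕ b))) a≤tb)

module _ {n : ℕ} where

  ≼⇒⊑ : ∀ {s t} {y x : Word n} → Nested n s → Nested n t → Encodes y s → Encodes x t → y ≼ x → s ⊑ t
  ≼⇒⊑ {s} {t} S T Ey Ex y≼x k with k <? s k
  ... | no k≮sk  = ≤-trans (≮⇒≥ k≮sk) (inflationary T k)
  ... | yes k<sk = ∀Fin⇒∀< (λ k → k < s k → s k ≤ t k) at-Fin k (<top⇒<n S k<sk) k<sk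
    where
    at-Fin : ∀ (b : Fin n) → toℕ b < s (toℕ b) → s (toℕ b) ≤ t (toℕ b)
    at-Fin b b<sb = ∀Fin⇒∀< (λ a → toℕ b < a → a ≤ s (toℕ b) → a ≤ t (toℕ b))
      (λ a b<a a≤sb → precedes⇒≤ Ex b<a (≼-inversion y≼x b<a (≤⇒precedes Ey a b b<a a≤sb)))
      (s (toℕ b)) (bounded S _ (FinP.toℕ<n b)) b<sb ≤-refl

  ⊑⇒≼ : ∀ {s t} {y x : Word n} → Permutation y → Permutation x → Encodes y s → Encodes x t → s ⊑ t → y ≼ x
  ⊑⇒≼ Py Px Ey Ex s⊑t =
    permutations-≼ Py Px (λ {a} {b} b<a p → ≤⇒precedes Ex a b b<a (≤-trans (precedes⇒≤ Ey b<a p) (s⊑t (toℕ b))))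

  encoding-unique : ∀ {s t} {x : Word n} → Nested n s → Nested n t → Encodes x s → Encodes x t → s ≐ t
  encoding-unique S T Es Et k = ≤-antisym (≼⇒⊑ S T Es Et ε k) (≼⇒⊑ T S Et Es ε k)

  decoding-unique : ∀ {t} {y x : Word n} → Permutation y → Permutation x → Encodes y t → Encodes x t → y ≡ x
  decoding-unique Py Px Ey Ex = ≼-antisym (⊑⇒≼ Py Px Ey Ex (λ _ → ≤-refl)) (⊑⇒≼ Px Py Ex Ey (λ _ → ≤-refl))

⊑-Fin⇒≐ : ∀ {n s t} → Nested n s → Nested n t → s ⊑ t →
          (∀ (k : Fin n) → ¬ s (toℕ k) < t (toℕ k)) → s ≐ t
⊑-Fin⇒≐ {n} {s} {t} S T s⊑t not-below k with k <? n
... | yes k<n = ≤-antisym (s⊑t k) (≮⇒≥ (∀Fin⇒∀< (λ k → ¬ s k < t k) not-below k k<n))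
... | no k≮n  = trans (outside S k (≮⇒≥ k≮n)) (sym (outside T k (≮⇒≥ k≮n)))

module PopInAv {n} {x : Word n} {t} (T : Nested n t) (x∈Av : InAv x) (Ex : Encodes x t) where
  private
    Px = inAv⇒permutation x x∈Av

  module _ {b} (b<tb : b < t b) where
    private
      L = lowerAt-nested T b<tb

    lowered : Word n
    lowered = decode L

    lowered-inAv : InAv lowered
    lowered-inAv = decode-inAv L

    lowered-encodes : Encodes lowered (lowerAt t b)
    lowered-encodes = decode-encodes L

    lowered<x : lowered <W x
    lowered<x = ⊑⇒≼ (decode-permutation L) Px lowered-encodes Ex (lowerAt⊑top T b<tb) ,
                λ e → <-irrefl (encoding-unique L T (subst (λ z → Encodes z (lowerAt t b)) e lowered-encodes) Ex b)
                               (subst (_< t b) (sym (lowerAt-at t b)) (pred-prev<top T b<tb))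

    lowered⋖x : lowered ⋖M x
    lowered⋖x = lowered-inAv , x∈Av , lowered<x , nothing-between
      where
      Pl = decode-permutation L
      nothing-between : ¬ Σ (Word n) λ z → InAv z × lowered <W z × z <W x
      nothing-between (z , z∈Av , (l≼z , l≢z) , (z≼x , z≢x))
        with lowerAt-between T b<tb (top-nested z z∈Av)
               (≼⇒⊑ L (top-nested z z∈Av) lowered-encodes (top-encodes z z∈Av) l≼z)
               (≼⇒⊑ (top-nested z z∈Av) T (top-encodes z z∈Av) Ex z≼x)
      ... | inj₁ z≐l = l≢z (decoding-unique Pl (inAv⇒permutation z z∈Av) lowered-encodes
                             (encodes-cong z≐l (top-encodes z z∈Av)))
      ... | inj₂ z≐t = z≢x (decoding-unique (inAv⇒permutation z z∈Av) Px (encodes-cong z≐t (top-encodes z z∈Av)) Ex)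

  ≼x⇒top⊑ : ∀ {y} → InAv y → y ≼ x → top y ⊑ t
  ≼x⇒top⊑ {y} y∈Av = ≼⇒⊑ (top-nested y y∈Av) T (top-encodes y y∈Av) Ex

  ⋖M⇒lowered : ∀ {y} → y ⋖M x → Σ ℕ λ b → Σ (b < t b) λ b<tb → Encodes y (lowerAt t b)
  ⋖M⇒lowered {y} (y∈Av , _ , (y≼x , y≢x) , nothing-between)
    with FinP.any? (λ (k : Fin n) → top y (toℕ k) <? t (toℕ k))
  ... | no none = ⊥-elim (y≢x (decoding-unique Py Px (encodes-cong top-y≐t (top-encodes y y∈Av)) Ex))
    where
    Py = inAv⇒permutation y y∈Av
    top-y≐t = ⊑-Fin⇒≐ (top-nested y y∈Av) T (≼x⇒top⊑ y∈Av y≼x) (λ k lt → none (k , lt))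
  ... | yes (k , lt) with below-lowerAt (top-nested y y∈Av) T (≼x⇒top⊑ y∈Av y≼x) lt
  ...   | b , b<tb , top-y⊑lowerAt with VecP.≡-dec FinP._≟_ y (lowered b<tb)
  ...     | yes refl = b , b<tb , lowered-encodes b<tb
  ...     | no y≢l   = ⊥-elim (nothing-between (lowered b<tb , lowered-inAv b<tb , (y≼l , y≢l) , lowered<x b<tb))
    where
    y≼l = ⊑⇒≼ (inAv⇒permutation y y∈Av) (decode-permutation (lowerAt-nested T b<tb))
                (top-encodes y y∈Av) (lowered-encodes b<tb) top-y⊑lowerAt

  popTop-lowerBound : ∀ {w} → Permutation w → Encodes w (popTop t) → ∀ y → PopSet x y → w ≼ y
  popTop-lowerBound Pw Ew y (_ , inj₂ refl) = ⊑⇒≼ Pw Px Ew Ex (popTop⊑top T)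
  popTop-lowerBound Pw Ew y (y∈Av , inj₁ y⋖x) with ⋖M⇒lowered y⋖x
  ... | b , b<tb , Ey = ⊑⇒≼ Pw (inAv⇒permutation y y∈Av) Ew Ey (popTop⊑lowerAt T b<tb)

  lowerBound⇒top⊑popTop : ∀ {v} → InAv v → (∀ y → PopSet x y → v ≼ y) → top v ⊑ popTop t
  lowerBound⇒top⊑popTop {v} v∈Av lb = ⊑popTop T (≼x⇒top⊑ v∈Av (lb x (x∈Av , inj₂ refl))) λ b<tb →
    ≼⇒⊑ (top-nested v v∈Av) (lowerAt-nested T b<tb) (top-encodes v v∈Av) (lowered-encodes b<tb)
        (lb (lowered b<tb) (lowered-inAv b<tb , inj₁ (lowered⋖x b<tb)))

  isPop⇒top≐popTop : ∀ {w} → IsPopOf x w → top w ≐ popTop t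
  isPop⇒top≐popTop {w} (w∈Av , lb , greatest) k =
    ≤-antisym (lowerBound⇒top⊑popTop w∈Av lb k) (≼⇒⊑ P (top-nested w w∈Av) (decode-encodes P) (top-encodes w w∈Av) p≼w k)
    where
    P = popTop-nested T
    p≼w = greatest (decode P) (decode-inAv P) (popTop-lowerBound (decode-permutation P) (decode-encodes P))

  encodes-popTop⇒isPop : ∀ {w} → InAv w → Encodes w (popTop t) → IsPopOf x w
  encodes-popTop⇒isPop {w} w∈Av Ew = w∈Av , popTop-lowerBound Pw Ew , λ v v∈Av lb →
    ⊑⇒≼ (inAv⇒permutation v v∈Av) Pw (top-encodes v v∈Av) Ew (lowerBound⇒top⊑popTop v∈Av lb)
    where Pw = inAv⇒permutation w w∈Av

ClosedBelow : ℕ → (ℕ → ℕ) → Set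
ClosedBelow m u = ∀ b → b < m → u b < m

PrevFixed : (ℕ → ℕ) → Set
PrevFixed u = ∀ {c} → c < u c → u (prev u c) ≡ prev u c

module _ {m t} (N : Nested (suc m) t) where

  popTop-closedBelow : ClosedBelow m (popTop t)
  popTop-closedBelow b b<m with b <? t b
  ... | no _     = b<m
  ... | yes b<tb = begin-strict
    pred (prev t b)  <⟨ ≤pred-prev⇒<prev N b<tb ≤-refl ⟩
    prev t b         ≤⟨ prev≤top N b<tb ⟩
    t b              ≤⟨ ≤-pred (bounded N b (m≤n⇒m≤1+n b<m)) ⟩
    m                ∎
    where open ≤-Reasoning

  popTop-prevFixed : PrevFixed (popTop t)
  popTop-prevFixed {c} c<uc = popTop-≮ t λ e<te → <-irrefl refl (begin-strict
    u e                  ≡⟨ popTop-< t e<te ⟩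
    pred (prev t e)      <⟨ pred-mono-< {{>-nonZero (0<prev N e<te)}} (≤-<-trans (prev≤top N e<te)
                              (top<prev-before-prev N c<tc (b<prev U c<uc) e<prev-t-c)) ⟩
    pred (prev t c)      ≡⟨ popTop-< t c<tc ⟨
    u c                  ≤⟨ top≤top-prev U c<uc ⟩
    u e                  ∎)
    where
    open ≤-Reasoning
    u = popTop t
    U = popTop-nested N
    e = prev u c
    c<tc : c < t c
    c<tc = <-≤-trans c<uc (popTop⊑top N c)
    e<prev-t-c : e < prev t c
    e<prev-t-c = ≤pred-prev⇒<prev N c<tc (subst (e ≤_) (popTop-< t c<tc) (prev≤top U c<uc))

module _ {n s u} (S : Nested n s) (U : Nested n u) (s≐u : s ≐ u) where

  prev-cong : ∀ {c} → c < s c → prev s c ≡ prev u c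
  prev-cong {c} c<sc = prev-unique S c<sc (b<prev U c<uc)
    (subst₂ _≤_ (sym (s≐u c)) (sym (s≐u _)) (top≤top-prev U c<uc))
    (λ c<j j<prev → subst₂ _<_ (sym (s≐u _)) (sym (s≐u c)) (top<top-before-prev U c<uc c<j j<prev))
    where c<uc = subst (c <_) (s≐u c) c<sc

  prevFixed-cong : PrevFixed u → PrevFixed s
  prevFixed-cong fixed {c} c<sc = begin
    s (prev s c)  ≡⟨ cong s (prev-cong c<sc) ⟩
    s (prev u c)  ≡⟨ s≐u _ ⟩
    u (prev u c)  ≡⟨ fixed (subst (c <_) (s≐u c) c<sc) ⟩
    prev u c      ≡⟨ prev-cong c<sc ⟨
    prev s c      ∎
    where open ≡-Reasoning

module PopPreimage {m u} (U : Nested (suc m) u) (closed : ClosedBelow m u) (fixed : PrevFixed u) where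

  Barrier : ℕ → ℕ → Set
  Barrier b a = b ≤ a × u a ≡ a × (∀ {j} → j < a → b ≤ j → u j < a)

  Barrier? : ∀ b a → Dec (Barrier b a)
  Barrier? b a = (b ≤? a) ×-dec (u a ≟ a) ×-dec allUpTo? (λ j → (b ≤? j) →-dec (u j <? a)) a

  open LeastSearch using (least; <least⇒¬P; P-least)

  preTop : ℕ → ℕ
  preTop b = least (Barrier b) (Barrier? b) (b + m)

  self-barrier : ∀ {b} → u b ≡ b → Barrier b b
  self-barrier ub≡b = ≤-refl , ub≡b , λ j<b b≤j → ⊥-elim (<⇒≱ j<b b≤j)

  u-m≡m : u m ≡ m
  u-m≡m = ≤-antisym (≤-pred (bounded U m ≤-refl)) (inflationary U m)

  preTop-barrier : ∀ b → Barrier b (preTop b)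
  preTop-barrier b with b ≤? m
  ... | yes b≤m = P-least (Barrier b) (Barrier? b) (b + m) (m≤n+m m b) (b≤m , u-m≡m , λ j<m _ → closed _ j<m)
  ... | no b≰m  = P-least (Barrier b) (Barrier? b) (b + m) (m≤m+n b m) (self-barrier (outside U b (≰⇒> b≰m)))

  preTop-least : ∀ {b a} → Barrier b a → preTop b ≤ a
  preTop-least {b} {a} barrier = ≮⇒≥ λ a<pre → <least⇒¬P (Barrier b) (Barrier? b) (b + m) a<pre barrier

  preTop-nested : Nested (suc m) preTop
  inflationary preTop-nested b = proj₁ (preTop-barrier b)
  bounded preTop-nested b b<sm =
    s≤s (preTop-least (≤-pred b<sm , u-m≡m , λ j<m _ → closed _ j<m))
  outside preTop-nested b sm≤b =
    ≤-antisym (preTop-least (self-barrier (outside U b sm≤b))) (inflationary preTop-nested b)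
  nested preTop-nested b a b<a a≤pre =
    preTop-least (a≤pre , proj₁ (proj₂ Bb) , λ j<pre a≤j → proj₂ (proj₂ Bb) j<pre (≤-trans (<⇒≤ b<a) a≤j))
    where Bb = preTop-barrier b

  module _ {k} (k<uk : k < u k) where
    private
      prev≡u-k : prev u k ≡ u k
      prev≡u-k = ≤-antisym (prev≤top U k<uk) (≤-trans (top≤top-prev U k<uk) (≤-reflexive (fixed k<uk)))

      u-u-k≡u-k : u (u k) ≡ u k
      u-u-k≡u-k = subst (λ e → u e ≡ e) prev≡u-k (fixed k<uk)

      below-u-k : ∀ {j} → k < j → j < u k → u j < u k
      below-u-k k<j j<uk = top<top-before-prev U k<uk k<j (subst (_ <_) (sym prev≡u-k) j<uk)

      k<preTop : k < preTop k
      k<preTop = ≤∧≢⇒< (inflationary preTop-nested k) λ k≡pre →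
        <-irrefl (trans k≡pre (trans (sym (proj₁ (proj₂ (preTop-barrier k)))) (cong u (sym k≡pre)))) k<uk

      u-k<preTop : u k < preTop k
      u-k<preTop = proj₂ (proj₂ (preTop-barrier k)) k<preTop ≤-refl

      preTop≤preTop-suc : preTop k ≤ preTop (suc (u k))
      preTop≤preTop-suc = preTop-least {k}
        (≤-trans (m<n⇒m≤1+n k<uk) (inflationary preTop-nested _) , proj₁ (proj₂ Bg) , arcs)
        where
        Bg = preTop-barrier (suc (u k))
        arcs : ∀ {j} → j < preTop (suc (u k)) → k ≤ j → u j < preTop (suc (u k))
        arcs {j} j<pre k≤j with suc (u k) ≤? j
        ... | yes g≤j = proj₂ (proj₂ Bg) j<pre g≤j
        ... | no g≰j  = <-≤-trans (s≤s uj≤uk) (inflationary preTop-nested _)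
          where
          uj≤uk : u j ≤ u k
          uj≤uk with k ≟ j
          ... | yes refl = ≤-refl
          ... | no k≢j   = nested U k j (≤∧≢⇒< k≤j k≢j) (≤-pred (≰⇒> g≰j))

      preTop-between : ∀ {j} → k < j → j < suc (u k) → preTop j < preTop k
      preTop-between {j} k<j j≤uk = ≤-<-trans
        (preTop-least {j} (≤-pred j≤uk , u-u-k≡u-k , λ i<uk j≤i → below-u-k (<-≤-trans k<j j≤i) i<uk))
        u-k<preTop

    popTop-preTop-< : popTop preTop k ≡ u k
    popTop-preTop-< = begin
      popTop preTop k         ≡⟨ popTop-< preTop k<preTop ⟩
      pred (prev preTop k)    ≡⟨ cong pred (prev-unique preTop-nested k<preTop (m<n⇒m<1+n k<uk)
                                  preTop≤preTop-suc preTop-between) ⟩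
      u k                     ∎
      where open ≡-Reasoning

  popTop-preTop : popTop preTop ≐ u
  popTop-preTop k with k <? u k
  ... | yes k<uk = popTop-preTop-< k<uk
  ... | no k≮uk  = trans (popTop-≮ preTop λ k<pre → <⇒≱ k<pre (preTop-least (self-barrier u-k≡k))) (sym u-k≡k)
    where u-k≡k = ≤-antisym (≮⇒≥ k≮uk) (inflationary U k)

module Positions {n} (x : Word n) (x∈Av : InAv x) where
  private
    inj = proj₁ x∈Av
    dx  = injective⇒distinct x inj
    ∈x  = injective⇒∈ x inj
    t   = top x
    T   = top-nested x x∈Av
    E   = top-encodes x x∈Av

    asFin : ∀ {k} → k < n → Σ (Fin n) λ f → toℕ f ≡ k
    asFin k<n = fromℕ< k<n , FinP.toℕ-fromℕ< k<n

  Adjacent : Fin n → Fin n → Set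
  Adjacent a b = Σ (Fin n) λ i → Σ (Fin n) λ j → toℕ j ≡ suc (toℕ i) × lookup x i ≡ a × lookup x j ≡ b

  adjacent-nothing-between : ∀ {a b c} → Adjacent a b → Precedes x a c → Precedes x c b → ⊥
  adjacent-nothing-between (i , j , j≡1+i , refl , refl) ac cb
    with precedes⇒lookup x ac | precedes⇒lookup x cb
  ... | i′ , k , i′<k , xᵢ′≡xᵢ , xₖ≡c | k′ , j′ , k′<j′ , xₖ′≡c , xⱼ′≡xⱼ
    with inj i′ i xᵢ′≡xᵢ | inj k′ k (trans xₖ′≡c (sym xₖ≡c)) | inj j′ j xⱼ′≡xⱼ
  ... | refl | refl | refl = <-irrefl refl (<-≤-trans i′<k (≤-pred (subst (toℕ k′ <_) j≡1+i k′<j′)))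

  adjacent-precedes : ∀ {a b} → Adjacent a b → Precedes x a b
  adjacent-precedes (i , j , j≡1+i , refl , refl) = lookup-precedes x (subst (toℕ i <_) (sym j≡1+i) ≤-refl)

  module _ {a b} (adj : Adjacent a b) (b<a : b <ᶠ a) where
    private
      a≤tb : toℕ a ≤ t (toℕ b)
      a≤tb = precedes⇒≤ E b<a (adjacent-precedes adj)

    descent⇒<top : toℕ b < t (toℕ b)
    descent⇒<top = <-≤-trans b<a a≤tb

    private
      tb≤ta : t (toℕ b) ≤ t (toℕ a)
      tb≤ta with toℕ a ≟ t (toℕ b)
      ... | yes a≡tb = ≤-trans (≤-reflexive (sym a≡tb)) (inflationary T (toℕ a))
      ... | no a≢tb with asFin (bounded T _ (FinP.toℕ<n b))
      ...   | f , f≡tb with precedes-total (∈x f) (∈x a) (λ { refl → a≢tb f≡tb })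
      ...     | inj₁ fa = subst (_≤ t (toℕ a)) f≡tb (precedes⇒≤ E (subst (toℕ a <_) (sym f≡tb) (≤∧≢⇒< a≤tb a≢tb)) fa)
      ...     | inj₂ af = ⊥-elim (adjacent-nothing-between adj af
                            (≤⇒precedes E f b (subst (toℕ b <_) (sym f≡tb) descent⇒<top) (≤-reflexive f≡tb)))

      between : ∀ {k} → toℕ b < k → k < toℕ a → t k < t (toℕ b)
      between {k} b<k k<a = ≰⇒> λ tb≤tk → case asFin (<-trans k<a (FinP.toℕ<n a)) of λ where
        (f , refl) → [ (λ fa → precedes-asym dx fa (≤⇒precedes E a f k<a (≤-trans a≤tb tb≤tk)))
                     , (λ af → adjacent-nothing-between adj af (≤⇒precedes E f b b<k (≤-trans (<⇒≤ k<a) a≤tb))) ]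
                     (precedes-total (∈x f) (∈x a) (λ { refl → <-irrefl refl k<a }))

    descent⇒prev : prev t (toℕ b) ≡ toℕ a
    descent⇒prev = prev-unique T descent⇒<top b<a tb≤ta between

  prev⇒adjacent : ∀ {a b} → toℕ b < t (toℕ b) → toℕ a ≡ prev t (toℕ b) → Adjacent a b
  prev⇒adjacent {a} {b} b<tb a≡prev with precedes⇒lookup x ab
    where
    ab : Precedes x a b
    ab = ≤⇒precedes E a b (subst (toℕ b <_) (sym a≡prev) (b<prev T b<tb))
                          (subst (_≤ t (toℕ b)) (sym a≡prev) (prev≤top T b<tb))
  ... | i , j , i<j , refl , refl with toℕ j ≟ suc (toℕ i)
  ...   | yes j≡1+i = i , j , j≡1+i , refl , refl
  ...   | no j≢1+i  = ⊥-elim (no-gap (lookup x k) ac cb)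
    where
    1+i<j : suc (toℕ i) < toℕ j
    1+i<j = ≤∧≢⇒< i<j (λ e → j≢1+i (sym e))
    k = fromℕ< (<-trans 1+i<j (FinP.toℕ<n j))
    k≡1+i = FinP.toℕ-fromℕ< (<-trans 1+i<j (FinP.toℕ<n j))
    ac = lookup-precedes x (subst (toℕ i <_) (sym k≡1+i) ≤-refl)
    cb = lookup-precedes x (subst (_< toℕ j) (sym k≡1+i) 1+i<j)
    A = toℕ (lookup x i)
    B = toℕ (lookup x j)
    no-gap : ∀ c → Precedes x (lookup x i) c → Precedes x c (lookup x j) → ⊥
    no-gap c ac cb with <-cmp (toℕ c) B | <-cmp (toℕ c) A
    ... | tri≈ _ c≡b _ | _ = precedes-≢ dx cb (FinP.toℕ-injective c≡b)
    ... | tri< c<b _ _ | _ = avoids312-precedes inj (proj₂ x∈Av) ac cb c<b (subst (B <_) (sym a≡prev) (b<prev T b<tb))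
    ... | tri> _ _ b<c | tri≈ _ c≡a _ = precedes-≢ dx ac (sym (FinP.toℕ-injective c≡a))
    ... | tri> _ _ b<c | tri< c<a _ _ = <-irrefl refl (begin-strict
          t (toℕ c)       <⟨ top<prev-before-prev T b<tb b<c (subst (toℕ c <_) a≡prev c<a) ⟩
          prev t B        ≡⟨ a≡prev ⟨
          A               ≤⟨ precedes⇒≤ E c<a ac ⟩
          t (toℕ c)       ∎)
      where open ≤-Reasoning
    ... | tri> _ _ b<c | tri> _ _ a<c = precedes-asym dx ac (≤⇒precedes E c (lookup x i) a<c (begin
          toℕ c           ≤⟨ precedes⇒≤ E b<c cb ⟩
          t B             ≤⟨ top≤top-prev T b<tb ⟩
          t (prev t B)    ≡⟨ cong t a≡prev ⟨
          t A             ∎))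
      where open ≤-Reasoning

  prevFixed⇒noDoubleDescent : PrevFixed t → NoDoubleDescent x
  prevFixed⇒noDoubleDescent fixed i j k j≡1+i k≡1+j (xₖ<xⱼ , xⱼ<xᵢ) =
    <-irrefl (sym (begin
      t (toℕ (lookup x j))          ≡⟨ cong t (descent⇒prev adjⱼₖ xₖ<xⱼ) ⟨
      t (prev t (toℕ (lookup x k))) ≡⟨ fixed (descent⇒<top adjⱼₖ xₖ<xⱼ) ⟩
      prev t (toℕ (lookup x k))     ≡⟨ descent⇒prev adjⱼₖ xₖ<xⱼ ⟩
      toℕ (lookup x j)              ∎))
      (descent⇒<top (i , j , j≡1+i , refl , refl) xⱼ<xᵢ)
    where
    open ≡-Reasoning
    adjⱼₖ : Adjacent (lookup x j) (lookup x k)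
    adjⱼₖ = j , k , k≡1+j , refl , refl

  noDoubleDescent⇒prevFixed : NoDoubleDescent x → PrevFixed t
  noDoubleDescent⇒prevFixed ndd {c} c<tc = ≤-antisym (≮⇒≥ double-descent) (inflationary T _)
    where
    double-descent : ¬ prev t c < t (prev t c)
    double-descent e<te with asFin (<top⇒<n T c<tc) | asFin (prev<n T c<tc) | asFin (prev<n T e<te)
    ... | c′ , refl | e′ , e′≡e | f′ , f′≡f
      with prev⇒adjacent c<tc e′≡e | prev⇒adjacent (subst (λ z → z < t z) (sym e′≡e) e<te) (trans f′≡f (cong (prev t) (sym e′≡e)))
    ... | i , j , j≡1+i , refl , refl | i′ , j′ , j′≡1+i′ , refl , xⱼ′≡xᵢ with inj j′ i xⱼ′≡xᵢ
    ... | refl = ndd i′ j′ j j′≡1+i′ j≡1+i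
                   (subst (toℕ c′ <_) (sym e′≡e) (b<prev T c<tc) ,
                    subst₂ _<_ (sym e′≡e) (sym f′≡f) (b<prev T e<te))

last≡lookup : ∀ {A : Set} {m} (xs : Vec A (suc m)) → last xs ≡ lookup xs (fromℕ m)
last≡lookup (x ∷ [])     = refl
last≡lookup (x ∷ y ∷ xs) = last≡lookup (y ∷ xs)

module LastPosition {m} (x : Word (suc m)) (x∈Av : InAv x) where
  private
    inj = proj₁ x∈Av
    t   = top x
    E   = top-encodes x x∈Av
    max = fromℕ m

    toℕ-max : toℕ max ≡ m
    toℕ-max = FinP.toℕ-fromℕ m

    <max : ∀ {i : Fin (suc m)} → i ≢ max → toℕ i < m
    <max i≢max = ≤∧≢⇒< (≤-pred (FinP.toℕ<n _)) (λ e → i≢max (FinP.toℕ-injective (trans e (sym toℕ-max))))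

  last⇒closedBelow : last x ≡ max → ClosedBelow m t
  last⇒closedBelow last≡max b b<m =
    ∀Fin⇒∀< (λ k → k < m → t k < m) (λ b′ b′<m → ≰⇒> (max-not-before b′ b′<m)) b (m<n⇒m<1+n b<m) b<m
    where
    max-not-before : ∀ b′ → toℕ b′ < m → ¬ m ≤ t (toℕ b′)
    max-not-before b′ b′<m m≤tb′
      with precedes⇒lookup x (≤⇒precedes E max b′ (subst (toℕ b′ <_) (sym toℕ-max) b′<m)
                                                   (subst (_≤ t (toℕ b′)) (sym toℕ-max) m≤tb′))
    ... | i , j , i<j , xᵢ≡max , _ with inj i max (trans xᵢ≡max (trans (sym last≡max) (last≡lookup x)))
    ... | refl = <-irrefl refl (<-≤-trans (subst (_< toℕ j) toℕ-max i<j) (≤-pred (FinP.toℕ<n j)))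

  closedBelow⇒last : ClosedBelow m t → last x ≡ max
  closedBelow⇒last closed with lookup x max FinP.≟ max | injective⇒∈ x inj max
  ... | yes v≡max | _ = trans (last≡lookup x) v≡max
  ... | no v≢max  | max∈x = ⊥-elim (<-irrefl refl (begin-strict
        m               ≡⟨ toℕ-max ⟨
        toℕ max         ≤⟨ precedes⇒≤ E v<max max-precedes-v ⟩
        t (toℕ v)       <⟨ closed (toℕ v) (<max v≢max) ⟩
        m               ∎))
    where
    open ≤-Reasoning
    v = lookup x max
    i = index max∈x
    xᵢ≡max : lookup x i ≡ max
    xᵢ≡max = sym (lookup-index max∈x)
    v<max : v <ᶠ max
    v<max = subst (toℕ v <_) (sym toℕ-max) (<max v≢max)
    max-precedes-v : Precedes x max v
    max-precedes-v = subst (λ z → Precedes x z v) xᵢ≡max (lookup-precedes x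
      (subst (toℕ i <_) (sym toℕ-max) (<max (λ i≡max → v≢max (trans (cong (lookup x) (sym i≡max)) xᵢ≡max)))))

module _ {m} (x : Word (suc m)) (x∈Av : InAv x) where
  private
    T = top-nested x x∈Av

  popImage⇒topConditions : InPopImage x → ClosedBelow m (top x) × PrevFixed (top x)
  popImage⇒topConditions (x′ , x′∈Av , isPop) =
    (λ b b<m → subst (_< m) (sym (top≐ b)) (popTop-closedBelow T′ b b<m)) ,
    prevFixed-cong T (popTop-nested T′) top≐ (popTop-prevFixed T′)
    where
    T′ = top-nested x′ x′∈Av
    top≐ = PopInAv.isPop⇒top≐popTop T′ x′∈Av (top-encodes x′ x′∈Av) isPop

  topConditions⇒popImage : ClosedBelow m (top x) → PrevFixed (top x) → InPopImage x
  topConditions⇒popImage closed fixed =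
    decode P , decode-inAv P ,
    PopInAv.encodes-popTop⇒isPop P (decode-inAv P) (decode-encodes P) x∈Av
      (encodes-cong (λ k → sym (popTop-preTop k)) (top-encodes x x∈Av))
    where
    open PopPreimage T closed fixed using (preTop-nested; popTop-preTop)
    P = preTop-nested

theorem4p7 : (m : ℕ) (x : Word (suc m)) → InAv x →
    (InPopImage x ⇔ (last x ≡ fromℕ m × NoDoubleDescent x))
theorem4p7 m x x∈Av = mk⇔
  (λ image → let (closed , fixed) = popImage⇒topConditions x x∈Av image in
               closedBelow⇒last closed , prevFixed⇒noDoubleDescent fixed)
  (λ (last≡max , ndd) → topConditions⇒popImage x x∈Av (last⇒closedBelow last≡max) (noDoubleDescent⇒prevFixed ndd))
  where
  open LastPosition x x∈Av
  open Positions x x∈Av
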